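{- Over the calculus QHC (described in the context): (a) The $\top$-Rule (from $?\alpha$ infer $\alpha$, for every problem $\alpha$) is equivalent to the rule: from $\nabla\alpha$ infer $\alpha$ (for every problem $\alpha$). (b) The $\bot$-Rule (from $\neg !p$ infer $\neg p$, for every proposition $p$) is equivalent to the rule: from $\Diamond p$ infer $p$ (for every proposition $p$), where $\Diamond p=\neg\Box\neg p$.
   Context: QHC (the joint logic of problems and propositions) is a two-sorted first-order calculus over a single domain of individuals. Formulas are of two sorts: propositions (letters $p,q$) and problems (letters $\alpha,\beta,\gamma$). Propositions are built from atomic propositions and from expressions $?\alpha$ ($\alpha$ a problem) by the classical connectives $\land,\lor,\to,\neg$, the constant $0$ (falsity) and quantifiers $\forall x,\exists x$. Problems are built from atomic problems and from expressions $!p$ ($p$ a proposition) by the intuitionistic connectives $\land,\lor,\to,\neg$, the constant $\bot$ and quantifiers $\forall x,\exists x$. Derivability in QHC: all axioms and rules of classical predicate logic apply to propositions, all axioms and rules of intuitionistic predicate logic apply to problems, and in addition there are the inference rules "from $\alpha$ infer $?\alpha$" and "from $p$ infer $!p$", and the axiom schemes $?(\alpha\to\beta)\to(?\alpha\to ?\beta)$, $!(p\to q)\to(!p\to !q)$, $\neg !0$, $?!p\to p$, $\alpha\to !?\alpha$. Abbreviations: $\Box p:= ?!p$, $\Diamond p:=\neg\Box\neg p$ for propositions, $\nabla\alpha := !?\alpha$ for problems. A rule (schema of inference) is added to QHC for all formulas of the indicated sort; two rules are equivalent if each is derivable in QHC extended by the other. -}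

module Defs where

open import Data.Nat using (ℕ; zero; suc)
open import Data.List using (List; map)
open import Data.Product using (_×_)
open import Relation.Binary.PropositionalEquality using (_≡_)

-- Individual variables are de Bruijn indices (ℕ); the only terms are
-- variables.
-- Pr = propositions (classical sort), Pb = problems (intuitionistic sort).

infixr 6 _∧ᶜ_ _∧ⁱ_
infixr 5 _∨ᶜ_ _∨ⁱ_
infixr 4 _⇒ᶜ_ _⇒ⁱ_

data Pr : Set
data Pb : Set

data Pr where
  atomᶜ : ℕ → List ℕ → Pr
  ¿_    : Pb → Pr
  _∧ᶜ_ _∨ᶜ_ _⇒ᶜ_ : Pr → Pr → Pr
  ¬ᶜ_   : Pr → Pr
  𝟘     : Pr
  ∀ᶜ ∃ᶜ : Pr → Pr

data Pb where
  atomⁱ : ℕ → List ℕ → Pb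
  ¡_    : Pr → Pb
  _∧ⁱ_ _∨ⁱ_ _⇒ⁱ_ : Pb → Pb → Pb
  ¬ⁱ_   : Pb → Pb
  ⊥ⁱ    : Pb
  ∀ⁱ ∃ⁱ : Pb → Pb

data Fm : Set where
  prop : Pr → Fm
  prob : Pb → Fm

□ : Pr → Pr
□ p = ¿ (¡ p)

◇ : Pr → Pr
◇ p = ¬ᶜ (□ (¬ᶜ p))

∇ : Pb → Pb
∇ α = ¡ (¿ α)

ext : (ℕ → ℕ) → ℕ → ℕ
ext ρ zero    = zero
ext ρ (suc n) = suc (ρ n)

renᶜ : (ℕ → ℕ) → Pr → Pr
renⁱ : (ℕ → ℕ) → Pb → Pb

renᶜ ρ (atomᶜ P xs) = atomᶜ P (map ρ xs)
renᶜ ρ (¿ α)        = ¿ (renⁱ ρ α)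
renᶜ ρ (p ∧ᶜ q)     = renᶜ ρ p ∧ᶜ renᶜ ρ q
renᶜ ρ (p ∨ᶜ q)     = renᶜ ρ p ∨ᶜ renᶜ ρ q
renᶜ ρ (p ⇒ᶜ q)     = renᶜ ρ p ⇒ᶜ renᶜ ρ q
renᶜ ρ (¬ᶜ p)       = ¬ᶜ renᶜ ρ p
renᶜ ρ 𝟘            = 𝟘
renᶜ ρ (∀ᶜ p)       = ∀ᶜ (renᶜ (ext ρ) p)
renᶜ ρ (∃ᶜ p)       = ∃ᶜ (renᶜ (ext ρ) p)

renⁱ ρ (atomⁱ P xs) = atomⁱ P (map ρ xs)
renⁱ ρ (¡ p)        = ¡ (renᶜ ρ p)
renⁱ ρ (α ∧ⁱ β)     = renⁱ ρ α ∧ⁱ renⁱ ρ β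
renⁱ ρ (α ∨ⁱ β)     = renⁱ ρ α ∨ⁱ renⁱ ρ β
renⁱ ρ (α ⇒ⁱ β)     = renⁱ ρ α ⇒ⁱ renⁱ ρ β
renⁱ ρ (¬ⁱ α)       = ¬ⁱ renⁱ ρ α
renⁱ ρ ⊥ⁱ           = ⊥ⁱ
renⁱ ρ (∀ⁱ α)       = ∀ⁱ (renⁱ (ext ρ) α)
renⁱ ρ (∃ⁱ α)       = ∃ⁱ (renⁱ (ext ρ) α)

-- weakening: the bound variable 0 does not occur in shifted formulas
shiftᶜ : Pr → Pr
shiftᶜ = renᶜ suc

shiftⁱ : Pb → Pb
shiftⁱ = renⁱ suc

-- instantiate the variable bound by a quantifier (index 0) by variable t
inst : ℕ → ℕ → ℕ
inst t zero    = t
inst t (suc n) = n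

instᶜ : ℕ → Pr → Pr
instᶜ t = renᶜ (inst t)

instⁱ : ℕ → Pb → Pb
instⁱ t = renⁱ (inst t)

data AxPr : Pr → Set where
  K    : ∀ {p q} → AxPr (p ⇒ᶜ (q ⇒ᶜ p))
  S    : ∀ {p q r} → AxPr ((p ⇒ᶜ (q ⇒ᶜ r)) ⇒ᶜ ((p ⇒ᶜ q) ⇒ᶜ (p ⇒ᶜ r)))
  ∧I   : ∀ {p q} → AxPr (p ⇒ᶜ (q ⇒ᶜ (p ∧ᶜ q)))
  ∧E₁  : ∀ {p q} → AxPr ((p ∧ᶜ q) ⇒ᶜ p)
  ∧E₂  : ∀ {p q} → AxPr ((p ∧ᶜ q) ⇒ᶜ q)
  ∨I₁  : ∀ {p q} → AxPr (p ⇒ᶜ (p ∨ᶜ q))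
  ∨I₂  : ∀ {p q} → AxPr (q ⇒ᶜ (p ∨ᶜ q))
  ∨E   : ∀ {p q r} → AxPr ((p ⇒ᶜ r) ⇒ᶜ ((q ⇒ᶜ r) ⇒ᶜ ((p ∨ᶜ q) ⇒ᶜ r)))
  𝟘E   : ∀ {p} → AxPr (𝟘 ⇒ᶜ p)
  ¬I   : ∀ {p} → AxPr ((p ⇒ᶜ 𝟘) ⇒ᶜ (¬ᶜ p))
  ¬E   : ∀ {p} → AxPr ((¬ᶜ p) ⇒ᶜ (p ⇒ᶜ 𝟘))
  ¬¬E  : ∀ {p} → AxPr ((¬ᶜ (¬ᶜ p)) ⇒ᶜ p)
  ∀E   : ∀ {p} (t : ℕ) → AxPr (∀ᶜ p ⇒ᶜ instᶜ t p)
  ∃I   : ∀ {p} (t : ℕ) → AxPr (instᶜ t p ⇒ᶜ ∃ᶜ p)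
  ?K   : ∀ {α β} → AxPr (¿ (α ⇒ⁱ β) ⇒ᶜ (¿ α ⇒ᶜ ¿ β))
  ?!E  : ∀ {p} → AxPr (¿ (¡ p) ⇒ᶜ p)

data AxPb : Pb → Set where
  K    : ∀ {α β} → AxPb (α ⇒ⁱ (β ⇒ⁱ α))
  S    : ∀ {α β γ} → AxPb ((α ⇒ⁱ (β ⇒ⁱ γ)) ⇒ⁱ ((α ⇒ⁱ β) ⇒ⁱ (α ⇒ⁱ γ)))
  ∧I   : ∀ {α β} → AxPb (α ⇒ⁱ (β ⇒ⁱ (α ∧ⁱ β)))
  ∧E₁  : ∀ {α β} → AxPb ((α ∧ⁱ β) ⇒ⁱ α)
  ∧E₂  : ∀ {α β} → AxPb ((α ∧ⁱ β) ⇒ⁱ β)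
  ∨I₁  : ∀ {α β} → AxPb (α ⇒ⁱ (α ∨ⁱ β))
  ∨I₂  : ∀ {α β} → AxPb (β ⇒ⁱ (α ∨ⁱ β))
  ∨E   : ∀ {α β γ} → AxPb ((α ⇒ⁱ γ) ⇒ⁱ ((β ⇒ⁱ γ) ⇒ⁱ ((α ∨ⁱ β) ⇒ⁱ γ)))
  ⊥E   : ∀ {α} → AxPb (⊥ⁱ ⇒ⁱ α)
  ¬I   : ∀ {α} → AxPb ((α ⇒ⁱ ⊥ⁱ) ⇒ⁱ (¬ⁱ α))
  ¬E   : ∀ {α} → AxPb ((¬ⁱ α) ⇒ⁱ (α ⇒ⁱ ⊥ⁱ))
  ∀E   : ∀ {α} (t : ℕ) → AxPb (∀ⁱ α ⇒ⁱ instⁱ t α)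
  ∃I   : ∀ {α} (t : ℕ) → AxPb (instⁱ t α ⇒ⁱ ∃ⁱ α)
  !K   : ∀ {p q} → AxPb (¡ (p ⇒ᶜ q) ⇒ⁱ (¡ p ⇒ⁱ ¡ q))
  ¬!0  : AxPb (¬ⁱ (¡ 𝟘))
  !?I  : ∀ {α} → AxPb (α ⇒ⁱ ¡ (¿ α))

-- A rule is given by its set of instances (premise, conclusion).
Rule : Set₁
Rule = Fm → Fm → Set

-- Der R Γ A : A is derivable in QHC extended by the rule R from the
-- hypotheses Γ (all rules, including R, may be applied to anything).
data Der (R : Rule) (Γ : Fm → Set) : Fm → Set where
  hyp   : ∀ {A} → Γ A → Der R Γ A
  extra : ∀ {A B} → R A B → Der R Γ A → Der R Γ B
  axᶜ   : ∀ {p} → AxPr p → Der R Γ (prop p)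
  axⁱ   : ∀ {α} → AxPb α → Der R Γ (prob α)
  mpᶜ   : ∀ {p q} → Der R Γ (prop (p ⇒ᶜ q)) → Der R Γ (prop p) → Der R Γ (prop q)
  mpⁱ   : ∀ {α β} → Der R Γ (prob (α ⇒ⁱ β)) → Der R Γ (prob α) → Der R Γ (prob β)
  -- quantifier rules: from q → p(x) infer q → ∀x p(x)  (x not free in q);
  --                   from p(x) → q infer ∃x p(x) → q  (x not free in q)
  ∀Rᶜ   : ∀ {p q} → Der R Γ (prop (shiftᶜ q ⇒ᶜ p)) → Der R Γ (prop (q ⇒ᶜ ∀ᶜ p))
  ∃Rᶜ   : ∀ {p q} → Der R Γ (prop (p ⇒ᶜ shiftᶜ q)) → Der R Γ (prop (∃ᶜ p ⇒ᶜ q))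
  ∀Rⁱ   : ∀ {α β} → Der R Γ (prob (shiftⁱ β ⇒ⁱ α)) → Der R Γ (prob (β ⇒ⁱ ∀ⁱ α))
  ∃Rⁱ   : ∀ {α β} → Der R Γ (prob (α ⇒ⁱ shiftⁱ β)) → Der R Γ (prob (∃ⁱ α ⇒ⁱ β))
  ?R    : ∀ {α} → Der R Γ (prob α) → Der R Γ (prop (¿ α))
  !R    : ∀ {p} → Der R Γ (prop p) → Der R Γ (prob (¡ p))

DerivableIn : Rule → Rule → Set
DerivableIn R′ R = ∀ {A B} → R′ A B → Der R (_≡ A) B

Equivalent : Rule → Rule → Set
Equivalent R₁ R₂ = DerivableIn R₁ R₂ × DerivableIn R₂ R₁

data TopRule : Rule where
  top : ∀ α → TopRule (prop (¿ α)) (prob α)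

data NablaRule : Rule where
  nabla : ∀ α → NablaRule (prob (∇ α)) (prob α)

data BotRule : Rule where
  bot : ∀ p → BotRule (prob (¬ⁱ (¡ p))) (prop (¬ᶜ p))

data DiaRule : Rule where
  dia : ∀ p → DiaRule (prop (◇ p)) (prop p)

-- (a) The two rules differ only by the round trip through ?: from ?α one gets
-- ∇α = !?α by the !-rule, and from ∇α one gets ?!?α by the ?-rule, which implies
-- ?α by ?!p → p.
-- (b) Both modalities preserve refutations: ¬p yields ¬!p through !p → !0 and
-- ¬!0, and ¬α yields ¬?α through ?α → ?⊥ → ?!0 and ?!0 → 0.  Hence ¬!p yields
-- ¬□¬¬p = ◇¬p, from which the ◇-rule gives ¬p; conversely ◇p = ¬?!¬p yields
-- ¬!?!¬p and so, by α → ∇α, ¬!¬p, from which the ⊥-rule gives ¬¬p, hence p.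
module Submission where

open import Defs
open import Data.Product using (_×_; _,_)
open import Relation.Binary.PropositionalEquality using (_≡_; refl)

module _ {R : Rule} {Γ : Fm → Set} where

  ⇒ᶜ-trans : ∀ {p q r} → Der R Γ (prop (p ⇒ᶜ q)) → Der R Γ (prop (q ⇒ᶜ r)) →
             Der R Γ (prop (p ⇒ᶜ r))
  ⇒ᶜ-trans p⇒q q⇒r = mpᶜ (mpᶜ (axᶜ S) (mpᶜ (axᶜ K) q⇒r)) p⇒q

  ⇒ⁱ-trans : ∀ {α β γ} → Der R Γ (prob (α ⇒ⁱ β)) → Der R Γ (prob (β ⇒ⁱ γ)) →
             Der R Γ (prob (α ⇒ⁱ γ))
  ⇒ⁱ-trans α⇒β β⇒γ = mpⁱ (mpⁱ (axⁱ S) (mpⁱ (axⁱ K) β⇒γ)) α⇒β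

  contraposeᶜ : ∀ {p q} → Der R Γ (prop (p ⇒ᶜ q)) → Der R Γ (prop (¬ᶜ q)) →
                Der R Γ (prop (¬ᶜ p))
  contraposeᶜ p⇒q ¬q = mpᶜ (axᶜ ¬I) (⇒ᶜ-trans p⇒q (mpᶜ (axᶜ ¬E) ¬q))

  contraposeⁱ : ∀ {α β} → Der R Γ (prob (α ⇒ⁱ β)) → Der R Γ (prob (¬ⁱ β)) →
                Der R Γ (prob (¬ⁱ α))
  contraposeⁱ α⇒β ¬β = mpⁱ (axⁱ ¬I) (⇒ⁱ-trans α⇒β (mpⁱ (axⁱ ¬E) ¬β))

  ¡-mono : ∀ {p q} → Der R Γ (prop (p ⇒ᶜ q)) → Der R Γ (prob (¡ p ⇒ⁱ ¡ q))
  ¡-mono p⇒q = mpⁱ (axⁱ !K) (!R p⇒q)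

  ¿-mono : ∀ {α β} → Der R Γ (prob (α ⇒ⁱ β)) → Der R Γ (prop (¿ α ⇒ᶜ ¿ β))
  ¿-mono α⇒β = mpᶜ (axᶜ ?K) (?R α⇒β)

  □-mono : ∀ {p q} → Der R Γ (prop (p ⇒ᶜ q)) → Der R Γ (prop (□ p ⇒ᶜ □ q))
  □-mono p⇒q = ¿-mono (¡-mono p⇒q)

  ¡-refute : ∀ {p} → Der R Γ (prop (¬ᶜ p)) → Der R Γ (prob (¬ⁱ (¡ p)))
  ¡-refute ¬p = contraposeⁱ (¡-mono (mpᶜ (axᶜ ¬E) ¬p)) (axⁱ ¬!0)

  ¿-refute : ∀ {α} → Der R Γ (prob (¬ⁱ α)) → Der R Γ (prop (¬ᶜ (¿ α)))
  ¿-refute ¬α =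
    mpᶜ (axᶜ ¬I) (⇒ᶜ-trans (¿-mono (mpⁱ (axⁱ ¬E) ¬α)) (⇒ᶜ-trans (¿-mono (axⁱ ⊥E)) (axᶜ ?!E)))

nabla-in-top : DerivableIn NablaRule TopRule
nabla-in-top (nabla α) = extra (top α) (mpᶜ (axᶜ ?!E) (?R (hyp refl)))

top-in-nabla : DerivableIn TopRule NablaRule
top-in-nabla (top α) = extra (nabla α) (!R (hyp refl))

dia-in-bot : DerivableIn DiaRule BotRule
dia-in-bot (dia p) = mpᶜ (axᶜ ¬¬E) (extra (bot (¬ᶜ p)) ¬!¬p)
  where
  ¬!¬p : Der BotRule (_≡ prop (◇ p)) (prob (¬ⁱ (¡ (¬ᶜ p))))
  ¬!¬p = contraposeⁱ (axⁱ !?I) (¡-refute (hyp refl))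

bot-in-dia : DerivableIn BotRule DiaRule
bot-in-dia (bot p) = extra (dia (¬ᶜ p)) ◇¬p
  where
  ◇¬p : Der DiaRule (_≡ prob (¬ⁱ (¡ p))) (prop (◇ (¬ᶜ p)))
  ◇¬p = contraposeᶜ (□-mono (axᶜ ¬¬E)) (¿-refute (hyp refl))

mainTheorem1 : Equivalent TopRule NablaRule × Equivalent BotRule DiaRule
mainTheorem1 = (top-in-nabla , nabla-in-top) , (bot-in-dia , dia-in-bot)
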